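{- For all integers $N>2$ and $k$ with $1<k<N-1$, \[ \theta(J(N,k)) \le \theta(J(N-1,k-1)) + \theta(J(N-1,k)). \]
   Context: For integers $0<k<N$, let $[N]=\{1,\dots,N\}$ and let $\mathcal{P}_k([N])$ be the set of $k$-element subsets of $[N]$. The Johnson graph $J(N,k)$ has vertex set $\mathcal{P}_k([N])$, two vertices $S_1,S_2$ being adjacent iff $|S_1\cap S_2| = k-1$. A (vertex) clique cover of a graph $G$ is a collection of cliques of $G$ whose vertex sets together contain every vertex of $G$; $\theta(G)$ denotes the smallest cardinality of a clique cover of $G$. -}

module Defs where

open import Data.Nat using (ℕ; _∸_; _≤_)
open import Data.Fin.Subset using (Subset; _∩_; ∣_∣)
open import Data.List using (List; length)
open import Data.List.Membership.Propositional using (_∈_)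
open import Data.List.Relation.Unary.All using (All)
open import Data.List.Relation.Unary.Any using (Any)
open import Data.Product using (_×_; ∃)
open import Relation.Binary.PropositionalEquality using (_≡_; _≢_)

-- Vertices of the Johnson graph J(N,k): k-element subsets of [N],
-- represented as subsets S of Fin N with ∣ S ∣ ≡ k.
IsVertex : (N k : ℕ) → Subset N → Set
IsVertex N k S = ∣ S ∣ ≡ k

-- Adjacency in J(N,k): |S₁ ∩ S₂| = k - 1 (for k-sets this already forces S₁ ≠ S₂).
Adjacent : (N k : ℕ) → Subset N → Subset N → Set
Adjacent N k S₁ S₂ = ∣ S₁ ∩ S₂ ∣ ≡ k ∸ 1

IsClique : (N k : ℕ) → List (Subset N) → Set
IsClique N k C =
  All (IsVertex N k) C ×
  (∀ {S₁ S₂} → S₁ ∈ C → S₂ ∈ C → S₁ ≢ S₂ → Adjacent N k S₁ S₂)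

IsCliqueCover : (N k : ℕ) → List (List (Subset N)) → Set
IsCliqueCover N k 𝒞 =
  All (IsClique N k) 𝒞 ×
  (∀ (S : Subset N) → IsVertex N k S → Any (S ∈_) 𝒞)

IsTheta : (N k t : ℕ) → Set
IsTheta N k t =
  ∃ (λ 𝒞 → IsCliqueCover N k 𝒞 × length 𝒞 ≡ t) ×
  (∀ 𝒞 → IsCliqueCover N k 𝒞 → t ≤ length 𝒞)

-- Split the k-subsets of [N] according to whether they contain the first element.
-- Those containing it correspond to (k-1)-subsets of the other N-1 elements, those
-- avoiding it to k-subsets; both correspondences shift |S₁ ∩ S₂| uniformly (by one,
-- resp. not at all), so they map cliques to cliques, and lifting minimum clique covers
-- of J(N-1,k-1) and J(N-1,k) along them gives a clique cover of J(N,k).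
module Submission where

open import Defs
open import Data.Nat using (ℕ; _+_; _≤_; _<_; _∸_; suc; s≤s)
open import Data.Nat.Properties using (suc-injective; ≤-trans; ≤-reflexive)
open import Data.Bool using (Bool; true; false)
open import Data.Vec using (_∷_)
open import Data.Fin.Subset using (Subset)
open import Data.List using (List; map; _++_; length)
open import Data.List.Properties using (length-++; length-map)
open import Data.List.Membership.Propositional using (_∈_)
open import Data.List.Membership.Propositional.Properties using (∈-map⁺; ∈-map⁻)
open import Data.List.Relation.Unary.All as All using (All)
import Data.List.Relation.Unary.All.Properties as All
open import Data.List.Relation.Unary.Any as Any using (Any)
import Data.List.Relation.Unary.Any.Properties as Any
open import Data.Product using (∃; _×_; _,_)
open import Function using (id)
open import Relation.Binary.PropositionalEquality using (_≡_; _≢_; refl; cong; cong₂)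
open Relation.Binary.PropositionalEquality.≡-Reasoning

private
  variable
    m n k k′ : ℕ

map⁺-isClique : (f : Subset m → Subset n) →
  (∀ {S} → IsVertex m k S → IsVertex n k′ (f S)) →
  (∀ {S₁ S₂} → Adjacent m k S₁ S₂ → Adjacent n k′ (f S₁) (f S₂)) →
  ∀ {C} → IsClique m k C → IsClique n k′ (map f C)
map⁺-isClique {n = n} {k′ = k′} f vertex adjacent {C} (vs , adj) =
  All.map⁺ (All.map vertex vs) , λ i₁ i₂ → image-adjacent (∈-map⁻ f i₁) (∈-map⁻ f i₂)
  where
  image-adjacent : ∀ {S₁ S₂} → ∃ (λ x → x ∈ C × S₁ ≡ f x) → ∃ (λ y → y ∈ C × S₂ ≡ f y) →
                   S₁ ≢ S₂ → Adjacent n k′ S₁ S₂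
  image-adjacent (x , x∈C , refl) (y , y∈C , refl) fx≢fy =
    adjacent (adj x∈C y∈C λ x≡y → fx≢fy (cong f x≡y))

cons-true-isClique : ∀ {C} → IsClique m (suc k) C → IsClique (suc m) (suc (suc k)) (map (true ∷_) C)
cons-true-isClique = map⁺-isClique (true ∷_) (cong suc) (cong suc)

cons-false-isClique : ∀ {C} → IsClique m k C → IsClique (suc m) k (map (false ∷_) C)
cons-false-isClique = map⁺-isClique (false ∷_) id id

consCover : Bool → List (List (Subset m)) → List (List (Subset (suc m)))
consCover b = map (map (b ∷_))

∈-consCover : ∀ b {S : Subset m} (𝒞 : List (List (Subset m))) →
  Any (S ∈_) 𝒞 → Any ((b ∷ S) ∈_) (consCover b 𝒞)
∈-consCover b 𝒞 S∈𝒞 = Any.map⁺ (Any.map (∈-map⁺ (b ∷_)) S∈𝒞)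

length-consCovers : (𝒞₁ 𝒞₂ : List (List (Subset m))) →
  length (consCover true 𝒞₁ ++ consCover false 𝒞₂) ≡ length 𝒞₁ + length 𝒞₂
length-consCovers 𝒞₁ 𝒞₂ = begin
  length (consCover true 𝒞₁ ++ consCover false 𝒞₂)
    ≡⟨ length-++ (consCover true 𝒞₁) ⟩
  length (consCover true 𝒞₁) + length (consCover false 𝒞₂)
    ≡⟨ cong₂ _+_ (length-map _ 𝒞₁) (length-map _ 𝒞₂) ⟩
  length 𝒞₁ + length 𝒞₂ ∎

consCovers-isCliqueCover : ∀ {𝒞₁ 𝒞₂} →
  IsCliqueCover m (suc k) 𝒞₁ → IsCliqueCover m (suc (suc k)) 𝒞₂ →
  IsCliqueCover (suc m) (suc (suc k)) (consCover true 𝒞₁ ++ consCover false 𝒞₂)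
consCovers-isCliqueCover {m} {k} {𝒞₁} {𝒞₂} (cliques₁ , covers₁) (cliques₂ , covers₂) =
  All.++⁺ (All.map⁺ (All.map cons-true-isClique cliques₁))
          (All.map⁺ (All.map cons-false-isClique cliques₂)) ,
  covers
  where
  covers : ∀ S → IsVertex (suc m) (suc (suc k)) S →
           Any (S ∈_) (consCover true 𝒞₁ ++ consCover false 𝒞₂)
  covers (true ∷ S) v = Any.++⁺ˡ (∈-consCover true 𝒞₁ (covers₁ S (suc-injective v)))
  covers (false ∷ S) v = Any.++⁺ʳ (consCover true 𝒞₁) (∈-consCover false 𝒞₂ (covers₂ S v))

θ-recurrence : ∀ {t t₁ t₂} →
  IsTheta (suc m) (suc (suc k)) t → IsTheta m (suc k) t₁ → IsTheta m (suc (suc k)) t₂ →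
  t ≤ t₁ + t₂
θ-recurrence (_ , minimal) ((𝒞₁ , cover₁ , refl) , _) ((𝒞₂ , cover₂ , refl) , _) =
  ≤-trans (minimal _ (consCovers-isCliqueCover cover₁ cover₂))
          (≤-reflexive (length-consCovers 𝒞₁ 𝒞₂))

proposition3p1 : ∀ (N k : ℕ) → 2 < N → 1 < k → k < N ∸ 1 →
    ∀ (t t₁ t₂ : ℕ) →
    IsTheta N k t → IsTheta (N ∸ 1) (k ∸ 1) t₁ → IsTheta (N ∸ 1) k t₂ →
    t ≤ t₁ + t₂
-- Only k ≥ 2 (and N ≥ 1, so that N ∸ 1 is a predecessor) is used.
proposition3p1 (suc m) (suc (suc k)) (s≤s _) (s≤s (s≤s _)) _ _ _ _ = θ-recurrence
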